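{- Let $\Sigma$ be an alphabet and $w\in\Sigma^*$. Then $w$ is a palindrome (i.e., $w=w^R$) if and only if, for all $a,b\in\Sigma$ with $a\neq b$, the word $h_{a,b}(w)$ is a palindrome.
   Context: $w^R$ denotes the reversal of $w$. For distinct $a,b\in\Sigma$, $h_{a,b}:\Sigma^*\to\{0,1\}^*$ is the monoid morphism with $a\mapsto 0$, $b\mapsto 1$ and $x\mapsto\lambda$ (empty word) for all other letters $x$. -}

module Defs where

open import Data.List using (List; []; _∷_; reverse)
open import Data.Bool using (Bool; true; false)
open import Relation.Binary.PropositionalEquality using (_≡_)
open import Relation.Binary.Definitions using (DecidableEquality)
open import Relation.Nullary using (yes; no)

IsPalindrome : ∀ {A : Set} → List A → Set
IsPalindrome w = w ≡ reverse w

-- Binary letters 0 and 1 are represented as false and true.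
-- h_{a,b} : Σ* → {0,1}*, the monoid morphism a ↦ 0, b ↦ 1, other letters ↦ λ.
h : ∀ {Σ : Set} → DecidableEquality Σ → Σ → Σ → List Σ → List Bool
h _≟_ a b [] = []
h _≟_ a b (x ∷ w) with x ≟ a
... | yes _ = false ∷ h _≟_ a b w
... | no _ with x ≟ b
...   | yes _ = true ∷ h _≟_ a b w
...   | no _ = h _≟_ a b w

{-# OPTIONS --safe #-}
-- h_{a,b} is a monoid morphism sending each letter to a palindrome (a word of length ≤ 1), so it
-- commutes with reversal; this gives the forward direction. Conversely, the maps h_{a,b} jointly
-- separate words of equal length: at the first position where u and v differ, say with letters
-- a ≠ b, h_{a,b} u and h_{a,b} v differ (0 against 1) after a common prefix. Applied to w and
-- w^R, which have the same length and the same images when every h_{a,b}(w) is a palindrome,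
-- this gives w = w^R.
module Submission where

open import Defs
open import Data.Nat using (ℕ)
open import Data.Fin using (Fin)
open import Data.Fin.Properties using (_≟_)
open import Data.List using (List)
open import Data.Product using (_×_)
open import Relation.Binary.PropositionalEquality using (_≢_)

open import Data.Bool using (true; false)
open import Data.Empty using (⊥-elim)
open import Data.List using ([]; _∷_; _++_; [_]; reverse; length)
open import Data.List.Properties
  using (∷-injectiveˡ; ++-cancelˡ; reverse-++; unfold-reverse; length-reverse)
open import Data.Nat.Properties using (suc-injective)
open import Data.Product using (_,_)
open import Relation.Binary.Definitions using (DecidableEquality)
open import Relation.Binary.PropositionalEquality
  using (_≡_; refl; sym; trans; cong; cong₂; module ≡-Reasoning)
open import Relation.Nullary using (yes; no)

module _ {A : Set} (_≟ᴬ_ : DecidableEquality A) where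

  h-++ : ∀ a b (u v : List A) → h _≟ᴬ_ a b (u ++ v) ≡ h _≟ᴬ_ a b u ++ h _≟ᴬ_ a b v
  h-++ a b [] v = refl
  h-++ a b (x ∷ u) v with x ≟ᴬ a
  ... | yes _ = cong (false ∷_) (h-++ a b u v)
  ... | no _ with x ≟ᴬ b
  ...   | yes _ = cong (true ∷_) (h-++ a b u v)
  ...   | no _ = h-++ a b u v

  h-[-]-isPalindrome : ∀ a b x → IsPalindrome (h _≟ᴬ_ a b [ x ])
  h-[-]-isPalindrome a b x with x ≟ᴬ a
  ... | yes _ = refl
  ... | no _ with x ≟ᴬ b
  ...   | yes _ = refl
  ...   | no _ = refl

  h-reverse : ∀ a b (w : List A) → h _≟ᴬ_ a b (reverse w) ≡ reverse (h _≟ᴬ_ a b w)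
  h-reverse a b [] = refl
  h-reverse a b (x ∷ w) = begin
    h _≟ᴬ_ a b (reverse (x ∷ w))              ≡⟨ cong (h _≟ᴬ_ a b) (unfold-reverse x w) ⟩
    h _≟ᴬ_ a b (reverse w ++ [ x ])           ≡⟨ h-++ a b (reverse w) [ x ] ⟩
    h _≟ᴬ_ a b (reverse w) ++ h _≟ᴬ_ a b [ x ] ≡⟨ cong₂ _++_ (h-reverse a b w) (h-[-]-isPalindrome a b x) ⟩
    reverse (h _≟ᴬ_ a b w) ++ reverse (h _≟ᴬ_ a b [ x ])
                                              ≡⟨ reverse-++ (h _≟ᴬ_ a b [ x ]) (h _≟ᴬ_ a b w) ⟨
    reverse (h _≟ᴬ_ a b [ x ] ++ h _≟ᴬ_ a b w) ≡⟨ cong reverse (h-++ a b [ x ] w) ⟨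
    reverse (h _≟ᴬ_ a b (x ∷ w))              ∎
    where open ≡-Reasoning

  h-∷-cancelˡ : ∀ a b x (u v : List A) →
    h _≟ᴬ_ a b (x ∷ u) ≡ h _≟ᴬ_ a b (x ∷ v) → h _≟ᴬ_ a b u ≡ h _≟ᴬ_ a b v
  h-∷-cancelˡ a b x u v eq = ++-cancelˡ (h _≟ᴬ_ a b [ x ]) _ _
    (trans (sym (h-++ a b [ x ] u)) (trans eq (h-++ a b [ x ] v)))

  h-first : ∀ a b (u : List A) → h _≟ᴬ_ a b (a ∷ u) ≡ false ∷ h _≟ᴬ_ a b u
  h-first a b u with a ≟ᴬ a
  ... | yes _ = refl
  ... | no a≢a = ⊥-elim (a≢a refl)

  h-second : ∀ {a b} (u : List A) → a ≢ b → h _≟ᴬ_ a b (b ∷ u) ≡ true ∷ h _≟ᴬ_ a b u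
  h-second {a} {b} u a≢b with b ≟ᴬ a
  ... | yes b≡a = ⊥-elim (a≢b (sym b≡a))
  ... | no _ with b ≟ᴬ b
  ...   | yes _ = refl
  ...   | no b≢b = ⊥-elim (b≢b refl)

  h-distinguishes-heads : ∀ {x y} (u v : List A) → x ≢ y →
    h _≟ᴬ_ x y (x ∷ u) ≢ h _≟ᴬ_ x y (y ∷ v)
  h-distinguishes-heads {x} {y} u v x≢y eq = false≢true (∷-injectiveˡ (begin
    false ∷ h _≟ᴬ_ x y u ≡⟨ h-first x y u ⟨
    h _≟ᴬ_ x y (x ∷ u)   ≡⟨ eq ⟩
    h _≟ᴬ_ x y (y ∷ v)   ≡⟨ h-second v x≢y ⟩
    true ∷ h _≟ᴬ_ x y v  ∎))
    where
      open ≡-Reasoning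
      false≢true : false ≢ true
      false≢true ()

  h-separates : ∀ (u v : List A) → length u ≡ length v →
    (∀ a b → a ≢ b → h _≟ᴬ_ a b u ≡ h _≟ᴬ_ a b v) → u ≡ v
  h-separates [] [] _ _ = refl
  h-separates (x ∷ u) (y ∷ v) |u|≡|v| same with x ≟ᴬ y
  ... | yes refl = cong (x ∷_) (h-separates u v (suc-injective |u|≡|v|)
                     λ a b a≢b → h-∷-cancelˡ a b x u v (same a b a≢b))
  ... | no x≢y = ⊥-elim (h-distinguishes-heads u v x≢y (same x y x≢y))

  palindrome⇒h-palindrome : ∀ (w : List A) → IsPalindrome w →
    ∀ a b → IsPalindrome (h _≟ᴬ_ a b w)
  palindrome⇒h-palindrome w w≡wᴿ a b = trans (cong (h _≟ᴬ_ a b) w≡wᴿ) (h-reverse a b w)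

  h-palindrome⇒palindrome : ∀ (w : List A) →
    (∀ a b → a ≢ b → IsPalindrome (h _≟ᴬ_ a b w)) → IsPalindrome w
  h-palindrome⇒palindrome w h-pal = h-separates w (reverse w) (sym (length-reverse w))
    λ a b a≢b → trans (h-pal a b a≢b) (sym (h-reverse a b w))

mainTheorem15 : (k : ℕ) → (w : List (Fin k)) →
    (IsPalindrome w → ((a b : Fin k) → a ≢ b → IsPalindrome (h _≟_ a b w)))
    × (((a b : Fin k) → a ≢ b → IsPalindrome (h _≟_ a b w)) → IsPalindrome w)
mainTheorem15 k w =
  (λ w-pal a b _ → palindrome⇒h-palindrome _≟_ w w-pal a b) , h-palindrome⇒palindrome _≟_ w
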